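{- Let $n\in\mathbb{N}$ not be a prime power, and suppose $\kappa(\mathcal{G}(\mathbb{Z}_n))=\delta(\mathcal{G}(\mathbb{Z}_n))=k$. Then $n$ is even and $k=\deg\big(\overline{n/2}\big)=n-\frac{n}{2^{\alpha}}$, where $\alpha$ is the largest integer such that $2^{\alpha}\mid n$.
   Context: $\mathbb{Z}_n$ is the additive group of integers modulo $n$. The power graph $\mathcal{G}(G)$ has vertex set $G$, distinct $u,v$ adjacent iff one is a positive integer power (multiple) of the other. $\delta$ is minimum degree and $\kappa$ is vertex connectivity (minimum number of vertices whose removal yields a disconnected or trivial graph). -}

module Defs where

open import Data.Nat using (ℕ; zero; suc; _*_; _^_; _≤_; _%_; NonZero)
open import Data.Nat.Divisibility using (_∣_)
open import Data.Nat.Primality using (Prime)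
open import Data.Fin using (Fin; toℕ)
open import Data.Fin.Subset using (Subset; _∉_; ∣_∣; ∁)
open import Data.List using (List; length)
open import Data.List.Membership.Propositional using (_∈_)
open import Data.List.Relation.Unary.Unique.Propositional using (Unique)
open import Data.Product using (Σ; ∃; _×_)
open import Data.Sum using (_⊎_)
open import Relation.Nullary using (¬_)
open import Relation.Binary.PropositionalEquality using (_≡_; _≢_)
open import Function.Bundles using (_⇔_)

-- n is a prime power p^m (m ≥ 0, so 1 = p^0 counts as a prime power)
IsPrimePower : ℕ → Set
IsPrimePower n = ∃ λ p → ∃ λ m → Prime p × n ≡ p ^ m

IsMultiple : (n : ℕ) .{{_ : NonZero n}} → Fin n → Fin n → Set
IsMultiple n u v = ∃ λ k → 1 ≤ k × (k * toℕ u) % n ≡ toℕ v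

Adj : (n : ℕ) .{{_ : NonZero n}} → Fin n → Fin n → Set
Adj n u v = u ≢ v × (IsMultiple n u v ⊎ IsMultiple n v u)

HasDegree : (n : ℕ) .{{_ : NonZero n}} → Fin n → ℕ → Set
HasDegree n v d =
  Σ (List (Fin n)) λ xs → Unique xs × length xs ≡ d × (∀ u → (u ∈ xs) ⇔ Adj n u v)

IsMinDegree : (n : ℕ) .{{_ : NonZero n}} → ℕ → Set
IsMinDegree n d =
  (∃ λ v → HasDegree n v d) × (∀ v e → HasDegree n v e → d ≤ e)

data Reach (n : ℕ) .{{_ : NonZero n}} (S : Subset n) : Fin n → Fin n → Set where
  here : ∀ {a} → a ∉ S → Reach n S a a
  step : ∀ {a b c} → Reach n S a b → c ∉ S → Adj n b c → Reach n S a c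

Separates : (n : ℕ) .{{_ : NonZero n}} → Subset n → Set
Separates n S =
  ∣ ∁ S ∣ ≤ 1 ⊎ (∃ λ a → ∃ λ b → a ∉ S × b ∉ S × ¬ Reach n S a b)

IsConnectivity : (n : ℕ) .{{_ : NonZero n}} → ℕ → Set
IsConnectivity n k =
  (∃ λ S → ∣ S ∣ ≡ k × Separates n S) × (∀ S → Separates n S → k ≤ ∣ S ∣)

module Submission where

-- Let v be a vertex of degree k = κ. We show v = n/2 by exhibiting, in every other case,
-- a vertex cut with fewer than k vertices:
--  * if v is adjacent to all other vertices, then k = n − 1, while for n = p^(m+1) · t
--    (p prime, p ∤ t, t ≥ 2) the vertices p^(m+1) and t are distinct and non-adjacent,
--    so the remaining n − 2 vertices form a cut;
--  * otherwise some y is not adjacent to v, so v ≠ 0 (0 is adjacent to everything); if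
--    moreover 2v ≠ n, then −v ≠ v generates the same cyclic subgroup as v, so every other
--    neighbour of −v is a neighbour of v, and the k − 1 neighbours of v other than −v
--    cut v off from y.
-- For the degree of n/2: its neighbours are 0 and the non-multiples of 2^α other than
-- n/2; since exactly q of the n residues are multiples of 2^α, there are n − q of them.

open import Defs
open import Data.Nat using (ℕ; zero; suc; _+_; _*_; _^_; _∸_; _<_; _≤_; z≤n; s≤s; s≤s⁻¹; NonZero; _%_; _/_; _≤?_;
  >-nonZero; >-nonZero⁻¹; ≢-nonZero; ≢-nonZero⁻¹) renaming (_≟_ to _≟ℕ_)
open import Data.Nat.Properties using (+-assoc; +-comm; +-identityʳ; *-comm; *-assoc; *-identityʳ; *-zeroʳ;
  *-cancelʳ-≡; *-mono-≤; +-mono-<; +-monoʳ-≤; m+n≡0⇒m≡0; m≤m+n; m<m*n; m≤m*n; m∸n+n≡m; n≢0⇒n>0;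
  ^-distribˡ-+-*; m^n≢0; m^n>0; m*n≢0; ≤-trans; ≤-reflexive; <-≤-trans; <-irrefl; ≰⇒>; module ≤-Reasoning)
open import Data.Nat.DivMod using (%-distribˡ-*; %-distribˡ-+; m%n%n≡m%n; m%n<n; m≡m%n+[m/n]*n; [m+kn]%n≡m%n;
  m<n⇒m%n≡m; m*n%n≡0; n%n≡0)
open import Data.Nat.Divisibility using (_∣_; _∣?_; divides; _∣0; ∣-refl; ∣-trans; ∣⇒≤; ∣1⇒≡1; m∣m*n; n∣m*n;
  ∣m⇒∣m*n; ∣n⇒∣m*n; ∣m+n∣m⇒∣n; ∣m∣n⇒∣m+n; %-presˡ-∣; m%n≡0⇒n∣m; *-cancelˡ-∣)
open import Data.Nat.Induction using (<-rec)
open import Data.Nat.Primality using (Prime; euclidsLemma; ¬prime[0]; ¬prime[1]; prime[2]; prime⇒irreducible;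
  prime⇒nonZero)
open import Data.Nat.Primality.Factorisation using (factorise)
open import Data.Nat.ListAction using (product)
open import Data.Nat.Tactic.RingSolver using (solve-∀)
open import Data.Fin using (Fin; zero; suc; toℕ; fromℕ<)
open import Data.Fin.Properties using (_≟_; toℕ<n; toℕ-fromℕ<; toℕ-injective; all?; ¬∀⟶∃¬)
open import Data.Fin.Subset using (Subset; inside; outside; ⊤; ⁅_⁆; ∁; _-_; ∣_∣)
  renaming (⊥ to ∅; _∈_ to _∈ₛ_; _∉_ to _∉ₛ_)
open import Data.Fin.Subset.Properties using (⊆-antisym; ∉⊥; ∈⊤; ∣⊥∣≡0; p─⊥≡p; p─q⊆p; x∈p∧x≢y⇒x∈p-y;
  p⊆q⇒∣p∣≤∣q∣; ∣∁p∣≡n∸∣p∣; x∉p⇒x∈∁p; x∈∁p⇒x∉p) renaming (_∈?_ to _∈ₛ?_)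
open import Data.Vec using (_∷_; []; tabulate; here; there)
open import Data.Vec.Properties using (lookup∘tabulate; []=⇒lookup; lookup⇒[]=)
open import Data.List using (List; length; []; _∷_)
import Data.List.Membership.DecPropositional as DecMembership
open import Data.List.Membership.Propositional using (_∈_; _∉_)
open import Data.List.Relation.Unary.Any using (here; there)
open import Data.List.Relation.Unary.All as All using (_∷_)
open import Data.List.Relation.Unary.AllPairs using (_∷_; [])
open import Data.List.Relation.Unary.Unique.Propositional using (Unique)
open import Data.Product using (Σ; _×_; _,_; proj₁; proj₂)
open import Data.Sum using (_⊎_; inj₁; inj₂)
open import Data.Empty using (⊥; ⊥-elim)
open import Relation.Nullary using (¬_; Dec; yes; no; does)
open import Relation.Nullary.Decidable using (dec-true; _⊎-dec_)
open import Relation.Binary.PropositionalEquality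
open import Function.Bundles using (Equivalence)
open Equivalence using (to; from)

⟦_⟧ : ∀ {n} {P : Fin n → Set} → (∀ i → Dec (P i)) → Subset n
⟦ P? ⟧ = tabulate (λ i → does (P? i))

∈⟦⟧⁺ : ∀ {n} {P : Fin n → Set} (P? : ∀ i → Dec (P i)) {i : Fin n} → P i → i ∈ₛ ⟦ P? ⟧
∈⟦⟧⁺ P? {i} p = lookup⇒[]= i _ (trans (lookup∘tabulate (λ j → does (P? j)) i) (dec-true (P? i) p))

∈⟦⟧⁻ : ∀ {n} {P : Fin n → Set} (P? : ∀ i → Dec (P i)) {i : Fin n} → i ∈ₛ ⟦ P? ⟧ → P i
∈⟦⟧⁻ P? {i} i∈ with P? i | trans (sym (lookup∘tabulate (λ j → does (P? j)) i)) ([]=⇒lookup i∈)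
... | yes p | _ = p
... | no _  | ()

x∉p-x : ∀ {n} (p : Subset n) (x : Fin n) → x ∉ₛ p - x
x∉p-x (_ ∷ p) zero    ()
x∉p-x (_ ∷ p) (suc x) (there x∈) = x∉p-x p x x∈

∈-remove⁻ : ∀ {n} {p : Subset n} {x i : Fin n} → i ∈ₛ p - x → i ∈ₛ p × i ≢ x
∈-remove⁻ {p = p} {x} i∈ = p─q⊆p p ⁅ x ⁆ i∈ , λ { refl → x∉p-x p x i∈ }

∣p∣≡1+∣p-x∣ : ∀ {n} {p : Subset n} {x : Fin n} → x ∈ₛ p → ∣ p ∣ ≡ suc ∣ p - x ∣
∣p∣≡1+∣p-x∣ {p = inside ∷ p}  {zero}  here        = cong suc (cong ∣_∣ (sym (p─⊥≡p p)))
∣p∣≡1+∣p-x∣ {p = inside ∷ p}  {suc x} (there x∈) = cong suc (∣p∣≡1+∣p-x∣ x∈)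
∣p∣≡1+∣p-x∣ {p = outside ∷ p} {suc x} (there x∈) = ∣p∣≡1+∣p-x∣ x∈

∣x∷p∣ : ∀ {n} x (p : Subset n) → ∣ x ∷ p ∣ ≡ ∣ x ∷ [] ∣ + ∣ p ∣
∣x∷p∣ inside  p = refl
∣x∷p∣ outside p = refl

dominates-or-misses : ∀ {n} (v : Fin n) (N : Subset n) →
  (∀ u → u ≢ v → u ∈ₛ N) ⊎ Σ (Fin n) λ y → y ≢ v × y ∉ₛ N
dominates-or-misses {n} v N with all? (λ u → (u ≟ v) ⊎-dec (u ∈ₛ? N))
... | yes all-in = inj₁ λ u u≢v → other (all-in u) u≢v
  where
  other : ∀ {u} → u ≡ v ⊎ u ∈ₛ N → u ≢ v → u ∈ₛ N
  other (inj₁ u≡v) u≢v = ⊥-elim (u≢v u≡v)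
  other (inj₂ u∈N) _   = u∈N
... | no ¬all-in with ¬∀⟶∃¬ n _ (λ u → (u ≟ v) ⊎-dec (u ∈ₛ? N)) ¬all-in
...   | y , y∉ = inj₂ (y , (λ y≡v → y∉ (inj₁ y≡v)) , (λ y∈N → y∉ (inj₂ y∈N)))

_∈?_ : ∀ {n} (i : Fin n) (xs : List (Fin n)) → Dec (i ∈ xs)
_∈?_ = DecMembership._∈?_ _≟_

elems : ∀ {n} → List (Fin n) → Subset n
elems xs = ⟦ (_∈? xs) ⟧

∣elems∣≡length : ∀ {n} (xs : List (Fin n)) → Unique xs → ∣ elems xs ∣ ≡ length xs
∣elems∣≡length {n} []       []         = trans (cong ∣_∣ noElems) (∣⊥∣≡0 n)
  where
  noMember : ∀ {i : Fin n} → i ∉ []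
  noMember ()
  noElems : elems {n} [] ≡ ∅
  noElems = ⊆-antisym (λ i∈ → ⊥-elim (noMember (∈⟦⟧⁻ (_∈? []) i∈))) (λ i∈ → ⊥-elim (∉⊥ i∈))
∣elems∣≡length (x ∷ xs) (x∉ ∷ uq) = begin
  ∣ elems (x ∷ xs) ∣      ≡⟨ ∣p∣≡1+∣p-x∣ (∈⟦⟧⁺ (_∈? (x ∷ xs)) (here refl)) ⟩
  suc ∣ elems (x ∷ xs) - x ∣ ≡⟨ cong (λ p → suc ∣ p ∣) (⊆-antisym drop add) ⟩
  suc ∣ elems xs ∣        ≡⟨ cong suc (∣elems∣≡length xs uq) ⟩
  suc (length xs)        ∎
  where
  open ≡-Reasoning
  drop : ∀ {i} → i ∈ₛ elems (x ∷ xs) - x → i ∈ₛ elems xs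
  drop i∈ = let i∈′ , i≢x = ∈-remove⁻ i∈ in tail (∈⟦⟧⁻ (_∈? (x ∷ xs)) i∈′) i≢x
    where
    tail : ∀ {i} → i ∈ x ∷ xs → i ≢ x → i ∈ₛ elems xs
    tail (here i≡x)   i≢x = ⊥-elim (i≢x i≡x)
    tail (there i∈xs) _   = ∈⟦⟧⁺ (_∈? xs) i∈xs
  add : ∀ {i} → i ∈ₛ elems xs → i ∈ₛ elems (x ∷ xs) - x
  add i∈ = x∈p∧x≢y⇒x∈p-y (∈⟦⟧⁺ (_∈? (x ∷ xs)) (there i∈xs)) (λ { refl → All.lookup x∉ i∈xs refl })
    where i∈xs = ∈⟦⟧⁻ (_∈? xs) i∈

below : {P : ℕ → Set} → (∀ j → Dec (P j)) → (m : ℕ) → Subset m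
below P? m = ⟦ (λ i → P? (toℕ i)) ⟧

count : {P : ℕ → Set} → (∀ j → Dec (P j)) → ℕ → ℕ
count P? m = ∣ below P? m ∣

count-suc : ∀ {P : ℕ → Set} (P? : ∀ j → Dec (P j)) m →
  count P? (suc m) ≡ count P? 1 + count (λ j → P? (suc j)) m
count-suc P? m = ∣x∷p∣ (does (P? 0)) (below (λ j → P? (suc j)) m)

count-+ : ∀ {P : ℕ → Set} (P? : ∀ j → Dec (P j)) a b →
  count P? (a + b) ≡ count P? a + count (λ j → P? (a + j)) b
count-+ P? zero    b = refl
count-+ P? (suc a) b = begin
  count P? (suc a + b)                                   ≡⟨ count-suc P? (a + b) ⟩
  count P? 1 + count P?′ (a + b)                         ≡⟨ cong (count P? 1 +_) (count-+ P?′ a b) ⟩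
  count P? 1 + (count P?′ a + count P?″ b)               ≡⟨ sym (+-assoc (count P? 1) _ _) ⟩
  count P? 1 + count P?′ a + count P?″ b                 ≡⟨ cong (_+ count P?″ b) (sym (count-suc P? a)) ⟩
  count P? (suc a) + count P?″ b                         ∎
  where
  open ≡-Reasoning
  P?′ = λ j → P? (suc j)
  P?″ = λ j → P? (suc a + j)

count-none : ∀ {P : ℕ → Set} (P? : ∀ j → Dec (P j)) m → (∀ (i : Fin m) → ¬ P (toℕ i)) → count P? m ≡ 0
count-none P? m none = trans (cong ∣_∣ below≡∅) (∣⊥∣≡0 m)
  where
  below≡∅ : below P? m ≡ ∅
  below≡∅ = ⊆-antisym (λ {i} i∈ → ⊥-elim (none i (∈⟦⟧⁻ (λ (i : Fin m) → P? (toℕ i)) i∈))) (λ i∈ → ⊥-elim (∉⊥ i∈))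

count-cong : ∀ {P Q : ℕ → Set} (P? : ∀ j → Dec (P j)) (Q? : ∀ j → Dec (Q j)) m →
  (∀ {j} → P j → Q j) → (∀ {j} → Q j → P j) → count P? m ≡ count Q? m
count-cong P? Q? m P⇒Q Q⇒P = cong ∣_∣ (⊆-antisym
  (λ i∈ → ∈⟦⟧⁺ (λ (i : Fin m) → Q? (toℕ i)) (P⇒Q (∈⟦⟧⁻ (λ (i : Fin m) → P? (toℕ i)) i∈)))
  (λ i∈ → ∈⟦⟧⁺ (λ (i : Fin m) → P? (toℕ i)) (Q⇒P (∈⟦⟧⁻ (λ (i : Fin m) → Q? (toℕ i)) i∈))))

count-multiples : ∀ d → 0 < d → ∀ q → count (d ∣?_) (q * d) ≡ q
count-multiples d d>0 zero    = refl
count-multiples d d>0 (suc q) = begin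
  count (d ∣?_) (d + q * d)                               ≡⟨ count-+ (d ∣?_) d (q * d) ⟩
  count (d ∣?_) d + count (λ j → d ∣? (d + j)) (q * d)   ≡⟨ cong₂ _+_ (first-block d d>0) shift ⟩
  1 + q                                                   ∎
  where
  open ≡-Reasoning
  first-block : ∀ d → 0 < d → count (d ∣?_) d ≡ 1
  first-block (suc e) _ = begin
    ∣ does (suc e ∣? 0) ∷ rest ∣          ≡⟨ cong (λ b → ∣ b ∷ rest ∣) (dec-true (suc e ∣? 0) (suc e ∣0)) ⟩
    suc (count (λ j → suc e ∣? suc j) e) ≡⟨ cong suc (count-none (λ j → suc e ∣? suc j) e no-multiple) ⟩
    1                                    ∎
    where
    rest = below (λ j → suc e ∣? suc j) e
    no-multiple : ∀ (i : Fin e) → ¬ suc e ∣ suc (toℕ i)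
    no-multiple i d∣ = <-irrefl refl (≤-trans (s≤s (toℕ<n i)) (∣⇒≤ d∣))
  shift : count (λ j → d ∣? (d + j)) (q * d) ≡ q
  shift = trans (count-cong (λ j → d ∣? (d + j)) (d ∣?_) (q * d) (λ d∣ → ∣m+n∣m⇒∣n d∣ ∣-refl) (∣m∣n⇒∣m+n ∣-refl))
                (count-multiples d d>0 q)

-- Vertex cuts in G(Z_n). A cut is certified by a vertex property that holds at one
-- surviving vertex, fails at another, and is preserved along the edges of G − S.

module _ {n : ℕ} .{{_ : NonZero n}} where

  adj-sym : ∀ {u v : Fin n} → Adj n u v → Adj n v u
  adj-sym (u≢v , inj₁ m) = (λ v≡u → u≢v (sym v≡u)) , inj₂ m
  adj-sym (u≢v , inj₂ m) = (λ v≡u → u≢v (sym v≡u)) , inj₁ m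

  adj-irrefl : ∀ {u : Fin n} → ¬ Adj n u u
  adj-irrefl (u≢u , _) = u≢u refl

  module Neighbourhood {v : Fin n} {d : ℕ} (deg : HasDegree n v d) where

    N : Subset n
    N = elems (proj₁ deg)

    ∣N∣ : ∣ N ∣ ≡ d
    ∣N∣ = let xs , unique , length≡d , _ = deg in trans (∣elems∣≡length xs unique) length≡d

    ∈N⁺ : ∀ {u} → Adj n u v → u ∈ₛ N
    ∈N⁺ {u} uv = ∈⟦⟧⁺ (_∈? proj₁ deg) (from (proj₂ (proj₂ (proj₂ deg)) u) uv)

    ∈N⁻ : ∀ {u} → u ∈ₛ N → Adj n u v
    ∈N⁻ {u} u∈ = to (proj₂ (proj₂ (proj₂ deg)) u) (∈⟦⟧⁻ (_∈? proj₁ deg) u∈)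

  Closed : Subset n → (Fin n → Set) → Set
  Closed S C = ∀ {b c} → C b → c ∉ₛ S → Adj n b c → C c

  reach-closed : ∀ {S C} {a c : Fin n} → Closed S C → C a → Reach n S a c → C c
  reach-closed closed Ca (here _)             = Ca
  reach-closed closed Ca (step path c∉S bc)  = closed (reach-closed closed Ca path) c∉S bc

  closed-separates : ∀ {S C} {a b : Fin n} → Closed S C → C a → ¬ C b → a ∉ₛ S → b ∉ₛ S → Separates n S
  closed-separates {a = a} {b} closed Ca ¬Cb a∉S b∉S =
    inj₂ (a , b , a∉S , b∉S , λ path → ¬Cb (reach-closed closed Ca path))

  SmallCut : ℕ → Set
  SmallCut d = Σ (Subset n) λ S → ∣ S ∣ < d × Separates n S

  no-small-cut : ∀ {k} → IsConnectivity n k → ¬ SmallCut k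
  no-small-cut (_ , minimal) (S , ∣S∣<k , cut) = <-irrefl refl (<-≤-trans ∣S∣<k (minimal S cut))

  -- If some
  -- y ≠ v is not adjacent to v, removing the deg v − 1 neighbours of v other than w
  -- leaves {v, w} closed, so it cuts v off from y.
  twin-cut : ∀ {v w y : Fin n} {d} → HasDegree n v d → Adj n w v →
    (∀ {c} → Adj n w c → c ≡ v ⊎ Adj n v c) → y ≢ v → ¬ Adj n y v → SmallCut d
  twin-cut {v} {w} {y} {d} deg wv twin y≢v y≁v =
    S , ∣S∣<d , closed-separates {C = C} closed (inj₁ refl) ¬Cy v∉S y∉S
    where
    open Neighbourhood deg
    S : Subset n
    S = N - w
    C : Fin n → Set
    C c = c ≡ v ⊎ c ≡ w
    ∣S∣<d : ∣ S ∣ < d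
    ∣S∣<d = ≤-reflexive (trans (sym (∣p∣≡1+∣p-x∣ (∈N⁺ wv))) ∣N∣)
    v-side : ∀ {c} → Adj n v c → c ∉ₛ S → c ≡ w
    v-side {c} vc c∉S with c ≟ w
    ... | yes c≡w = c≡w
    ... | no  c≢w = ⊥-elim (c∉S (x∈p∧x≢y⇒x∈p-y (∈N⁺ (adj-sym vc)) c≢w))
    closed : Closed S C
    closed (inj₁ refl) c∉S vc = inj₂ (v-side vc c∉S)
    closed (inj₂ refl) c∉S wc with twin wc
    ... | inj₁ c≡v = inj₁ c≡v
    ... | inj₂ vc  = inj₂ (v-side vc c∉S)
    ¬Cy : ¬ C y
    ¬Cy (inj₁ y≡v)  = y≢v y≡v
    ¬Cy (inj₂ refl) = y≁v wv
    v∉S : v ∉ₛ S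
    v∉S v∈S = adj-irrefl (∈N⁻ (proj₁ (∈-remove⁻ v∈S)))
    y∉S : y ∉ₛ S
    y∉S y∈S = y≁v (∈N⁻ (proj₁ (∈-remove⁻ y∈S)))

  dominating-cut : ∀ {v a b : Fin n} {d} → HasDegree n v d → (∀ u → u ≢ v → Adj n u v) →
    a ≢ b → ¬ Adj n a b → SmallCut d
  dominating-cut {v} {a} {b} {d} deg dominating a≢b a≁b =
    S , ∣S∣<d , closed-separates {C = _≡ a} closed refl (λ b≡a → a≢b (sym b≡a)) a∉S b∉S
    where
    open Neighbourhood deg
    S : Subset n
    S = ⊤ - a - b
    ∣S∣<d : ∣ S ∣ < d
    ∣S∣<d = s≤s⁻¹ (begin
      suc (suc ∣ S ∣)  ≡⟨ cong suc (sym (∣p∣≡1+∣p-x∣ (x∈p∧x≢y⇒x∈p-y (∈⊤ {x = b}) (λ b≡a → a≢b (sym b≡a))))) ⟩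
      suc ∣ ⊤ - a ∣     ≡⟨ sym (∣p∣≡1+∣p-x∣ (∈⊤ {x = a})) ⟩
      ∣ ⊤ {n} ∣         ≡⟨ ∣p∣≡1+∣p-x∣ (∈⊤ {x = v}) ⟩
      suc ∣ ⊤ - v ∣     ≤⟨ s≤s (p⊆q⇒∣p∣≤∣q∣ others⊆N) ⟩
      suc ∣ N ∣         ≡⟨ cong suc ∣N∣ ⟩
      suc d             ∎)
      where
      open ≤-Reasoning
      others⊆N : ∀ {u} → u ∈ₛ ⊤ - v → u ∈ₛ N
      others⊆N {u} u∈ = ∈N⁺ (dominating u (proj₂ (∈-remove⁻ {p = ⊤} u∈)))
    survivor : ∀ {c} → c ∉ₛ S → c ≡ a ⊎ c ≡ b
    survivor {c} c∉S with c ≟ a | c ≟ b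
    ... | yes c≡a | _       = inj₁ c≡a
    ... | no  _   | yes c≡b = inj₂ c≡b
    ... | no  c≢a | no  c≢b = ⊥-elim (c∉S (x∈p∧x≢y⇒x∈p-y (x∈p∧x≢y⇒x∈p-y ∈⊤ c≢a) c≢b))
    closed : Closed S (_≡ a)
    closed refl c∉S ac with survivor c∉S
    ... | inj₁ c≡a  = c≡a
    ... | inj₂ refl = ⊥-elim (a≁b ac)
    a∉S : a ∉ₛ S
    a∉S a∈S = proj₂ (∈-remove⁻ (proj₁ (∈-remove⁻ a∈S))) refl
    b∉S : b ∉ₛ S
    b∉S b∈S = proj₂ (∈-remove⁻ b∈S) refl

%-mul-assoc : ∀ n .{{_ : NonZero n}} a b x → (a * ((b * x) % n)) % n ≡ (a * b * x) % n
%-mul-assoc n a b x = begin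
  (a * ((b * x) % n)) % n              ≡⟨ %-distribˡ-* a ((b * x) % n) n ⟩
  ((a % n) * ((b * x) % n % n)) % n    ≡⟨ cong (λ y → ((a % n) * y) % n) (m%n%n≡m%n (b * x) n) ⟩
  ((a % n) * ((b * x) % n)) % n        ≡⟨ %-distribˡ-* a (b * x) n ⟨
  (a * (b * x)) % n                    ≡⟨ cong (_% n) (*-assoc a b x) ⟨
  (a * b * x) % n                      ∎
  where open ≡-Reasoning

n∣2t⇒2t≡n : ∀ {n t} → 0 < t → t < n → n ∣ t + t → t * 2 ≡ n
n∣2t⇒2t≡n t>0 t<n (divides zero t+t≡0) = ⊥-elim (<-irrefl (sym (m+n≡0⇒m≡0 _ t+t≡0)) t>0)
n∣2t⇒2t≡n {n} {t} _ _ (divides 1 t+t≡n) = trans (twice t) (trans t+t≡n (+-identityʳ n))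
  where
  twice : ∀ t → t * 2 ≡ t + t
  twice = solve-∀
n∣2t⇒2t≡n {n} _ t<n (divides (suc (suc c)) t+t≡) =
  ⊥-elim (<-irrefl refl (<-≤-trans (+-mono-< t<n t<n) (≤-trans (+-monoʳ-≤ n (m≤m+n n (c * n))) (≤-reflexive (sym t+t≡)))))

∣-multiple-mod : ∀ {d x n} .{{_ : NonZero n}} k → d ∣ n → d ∣ x → d ∣ (k * x) % n
∣-multiple-mod k d∣n d∣x = %-presˡ-∣ (∣n⇒∣m*n k d∣x) d∣n

^-∣ : ∀ p {a b} → a ≤ b → p ^ a ∣ p ^ b
^-∣ p {a} {b} a≤b = divides (p ^ (b ∸ a)) (trans (cong (p ^_) (sym (m∸n+n≡m a≤b))) (^-distribˡ-+-* p (b ∸ a) a))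

odd⇒%2≡1 : ∀ s → ¬ 2 ∣ s → s % 2 ≡ 1
odd⇒%2≡1 s 2∤s with s % 2 in s%2≡ | m%n<n s 2
... | 0           | _ = ⊥-elim (2∤s (m%n≡0⇒n∣m s 2 s%2≡))
... | 1           | _ = refl
... | suc (suc _) | s≤s (s≤s ())

odd-part : ∀ {n α q} → n ≡ 2 ^ α * q → ¬ 2 ^ suc α ∣ n → ¬ 2 ∣ q
odd-part {α = α} n≡ 2^[1+α]∤n (divides r refl) = 2^[1+α]∤n (divides r (trans n≡ (regroup (2 ^ α) r)))
  where
  regroup : ∀ a r → a * (r * 2) ≡ r * (2 * a)
  regroup = solve-∀

prime≥2 : ∀ {p} → Prime p → 2 ≤ p
prime≥2 {0}             p-prime = ⊥-elim (¬prime[0] p-prime)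
prime≥2 {1}             p-prime = ⊥-elim (¬prime[1] p-prime)
prime≥2 {suc (suc _)} _       = s≤s (s≤s z≤n)

prime-divisor : ∀ t → 2 ≤ t → Σ ℕ λ r → Prime r × r ∣ t
prime-divisor t t≥2 with factorise t {{>-nonZero (≤-trans (s≤s z≤n) t≥2)}}
... | record { factors = [] ; isFactorisation = t≡1 } = ⊥-elim (<-irrefl (sym t≡1) t≥2)
... | record { factors = r ∷ rs ; isFactorisation = t≡ ; factorsPrime = r-prime ∷ _ } =
  r , r-prime , divides (product rs) (trans t≡ (*-comm r (product rs)))

prime∣^⇒∣ : ∀ {r p} m → Prime r → r ∣ p ^ m → r ∣ p
prime∣^⇒∣ zero    r-prime r∣1 = ⊥-elim (¬prime[1] (subst Prime (∣1⇒≡1 r∣1) r-prime))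
prime∣^⇒∣ {p = p} (suc m) r-prime r∣p^[1+m] with euclidsLemma p (p ^ m) r-prime r∣p^[1+m]
... | inj₁ r∣p   = r∣p
... | inj₂ r∣p^m = prime∣^⇒∣ m r-prime r∣p^m

factor-out : ∀ p → 2 ≤ p → ∀ u → 0 < u → Σ ℕ λ m → Σ ℕ λ t → u ≡ p ^ m * t × ¬ p ∣ t
factor-out p p≥2 = <-rec _ peel
  where
  peel : ∀ u → (∀ {u′} → u′ < u → 0 < u′ → Σ ℕ λ m → Σ ℕ λ t → u′ ≡ p ^ m * t × ¬ p ∣ t) →
         0 < u → Σ ℕ λ m → Σ ℕ λ t → u ≡ p ^ m * t × ¬ p ∣ t
  peel u rec u>0 with p ∣? u
  ... | no  p∤u = 0 , u , sym (+-identityʳ u) , p∤u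
  ... | yes (divides zero u≡0) = ⊥-elim (<-irrefl (sym u≡0) u>0)
  ... | yes (divides (suc q) u≡) =
    let m , t , [1+q]≡ , p∤t = rec q<u (s≤s z≤n) in suc m , t , u≡p^[1+m]t {m} {t} [1+q]≡ , p∤t
    where
    q<u : suc q < u
    q<u = subst (suc q <_) (sym u≡) (m<m*n (suc q) p p≥2)
    u≡p^[1+m]t : ∀ {m t} → suc q ≡ p ^ m * t → u ≡ p * p ^ m * t
    u≡p^[1+m]t {m} {t} [1+q]≡ = begin
      u                 ≡⟨ u≡ ⟩
      suc q * p         ≡⟨ *-comm (suc q) p ⟩
      p * suc q         ≡⟨ cong (p *_) [1+q]≡ ⟩
      p * (p ^ m * t)   ≡⟨ *-assoc p (p ^ m) t ⟨
      p * p ^ m * t     ∎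
      where open ≡-Reasoning

∤prime-power : ∀ {p t} m → Prime p → ¬ p ∣ t → 2 ≤ t → ¬ t ∣ p ^ m
∤prime-power m p-prime p∤t t≥2 t∣p^m with prime-divisor _ t≥2
... | r , r-prime , r∣t with prime⇒irreducible p-prime (prime∣^⇒∣ m r-prime (∣-trans r∣t t∣p^m))
...   | inj₁ r≡1 = ¬prime[1] (subst Prime r≡1 r-prime)
...   | inj₂ r≡p = p∤t (subst (_∣ _) r≡p r∣t)

positive≢1⇒≥2 : ∀ n → 0 < n → n ≢ 1 → 2 ≤ n
positive≢1⇒≥2 (suc zero)    _ n≢1 = ⊥-elim (n≢1 refl)
positive≢1⇒≥2 (suc (suc _)) _ _   = s≤s (s≤s z≤n)

split-prime-power : ∀ n .{{_ : NonZero n}} → ¬ IsPrimePower n →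
  Σ ℕ λ p → Σ ℕ λ m → Σ ℕ λ t → Prime p × n ≡ p ^ suc m * t × ¬ p ∣ t × 2 ≤ t
split-prime-power n not-pp with prime-divisor n (positive≢1⇒≥2 n (>-nonZero⁻¹ n) (λ n≡1 → not-pp (2 , 0 , prime[2] , n≡1)))
... | p , p-prime , p∣n with factor-out p (prime≥2 p-prime) n (>-nonZero⁻¹ n)
...   | zero  , t , n≡t , p∤t = ⊥-elim (p∤t (subst (p ∣_) (trans n≡t (+-identityʳ t)) p∣n))
...   | suc m , t , n≡ , p∤t =
  p , m , t , p-prime , n≡ , p∤t , positive≢1⇒≥2 t t>0 (λ t≡1 → not-pp (p , suc m , p-prime , trans n≡ (trans (cong (p ^ suc m *_) t≡1) (*-identityʳ (p ^ suc m)))))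
  where
  t>0 : 0 < t
  t>0 = n≢0⇒n>0 λ t≡0 → ≢-nonZero⁻¹ n (trans n≡ (trans (cong (p ^ suc m *_) t≡0) (*-zeroʳ (p ^ suc m))))

module _ {n : ℕ} .{{_ : NonZero n}} where

  multiple-trans : ∀ {u v w : Fin n} → IsMultiple n u v → IsMultiple n v w → IsMultiple n u w
  multiple-trans {u} {v} {w} (k , k≥1 , ku≡v) (l , l≥1 , lv≡w) = l * k , *-mono-≤ l≥1 k≥1 , (begin
    (l * k * toℕ u) % n         ≡⟨ %-mul-assoc n l k (toℕ u) ⟨
    (l * ((k * toℕ u) % n)) % n ≡⟨ cong (λ y → (l * y) % n) ku≡v ⟩
    (l * toℕ v) % n             ≡⟨ lv≡w ⟩
    toℕ w                       ∎)
    where open ≡-Reasoning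

  twin-neighbours : ∀ {v w : Fin n} → IsMultiple n v w → IsMultiple n w v →
    ∀ {c} → Adj n w c → c ≡ v ⊎ Adj n v c
  twin-neighbours {v} {w} v∣w w∣v {c} (_ , w~c) with c ≟ v
  ... | yes c≡v = inj₁ c≡v
  ... | no  c≢v = inj₂ ((λ v≡c → c≢v (sym v≡c)) , via w~c)
    where
    via : IsMultiple n w c ⊎ IsMultiple n c w → IsMultiple n v c ⊎ IsMultiple n c v
    via (inj₁ w∣c) = inj₁ (multiple-trans v∣w w∣c)
    via (inj₂ c∣w) = inj₂ (multiple-trans c∣w w∣v)

  adjacent-to-zero : ∀ {u z : Fin n} → toℕ z ≡ 0 → u ≢ z → Adj n u z
  adjacent-to-zero {u} z≡0 u≢z = u≢z , inj₁ (n , >-nonZero⁻¹ n , trans (cong (_% n) (*-comm n (toℕ u))) (trans (m*n%n≡0 (toℕ u) n) (sym z≡0)))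

-- For v ≠ 0 with 2v ≠ n, the vertex −v = (n − 1)·v differs from v, and each of v, −v is a
-- multiple of the other (since (n − 1)² ≡ 1 mod n).
negative-twin : ∀ {n} .{{_ : NonZero n}} (v : Fin n) → toℕ v ≢ 0 → toℕ v * 2 ≢ n →
  Σ (Fin n) λ w → w ≢ v × IsMultiple n v w × IsMultiple n w v
negative-twin {suc zero} zero v≢0 _ = ⊥-elim (v≢0 refl)
negative-twin {suc (suc j)} v v≢0 2v≢n =
  w , w≢v , (suc j , s≤s z≤n , sym toℕw) , (suc j , s≤s z≤n , back)
  where
  open ≡-Reasoning
  n = suc (suc j)
  t = toℕ v
  w : Fin n
  w = fromℕ< (m%n<n (suc j * t) n)
  toℕw : toℕ w ≡ (suc j * t) % n
  toℕw = toℕ-fromℕ< (m%n<n (suc j * t) n)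
  square : suc j * suc j * t ≡ t + j * t * suc (suc j)
  square = expand j t
    where
    expand : ∀ j t → suc j * suc j * t ≡ t + j * t * suc (suc j)
    expand = solve-∀
  back : (suc j * toℕ w) % n ≡ t
  back = begin
    (suc j * toℕ w) % n               ≡⟨ cong (λ y → (suc j * y) % n) toℕw ⟩
    (suc j * ((suc j * t) % n)) % n   ≡⟨ %-mul-assoc n (suc j) (suc j) t ⟩
    (suc j * suc j * t) % n           ≡⟨ cong (_% n) square ⟩
    (t + j * t * n) % n               ≡⟨ [m+kn]%n≡m%n t (j * t) n ⟩
    t % n                             ≡⟨ m<n⇒m%n≡m (toℕ<n v) ⟩
    t                                 ∎
  w≢v : w ≢ v
  w≢v w≡v = 2v≢n (n∣2t⇒2t≡n (n≢0⇒n>0 v≢0) (toℕ<n v) (m%n≡0⇒n∣m (t + t) n (begin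
    (t + t) % n                       ≡⟨ cong (λ y → (y + t) % n) (trans (sym toℕw) (cong toℕ w≡v)) ⟨
    ((suc j * t) % n + t) % n         ≡⟨ cong (λ y → ((suc j * t) % n + y) % n) (m<n⇒m%n≡m (toℕ<n v)) ⟨
    ((suc j * t) % n + t % n) % n     ≡⟨ %-distribˡ-+ (suc j * t) t n ⟨
    (suc j * t + t) % n               ≡⟨ cong (_% n) (trans (+-comm (suc j * t) t) (*-comm n t)) ⟩
    (t * n) % n                       ≡⟨ m*n%n≡0 t n ⟩
    0                                 ∎)))

-- If n is not a prime power, G(Z_n) has two distinct non-adjacent vertices:
-- writing n = p ^ (m + 1) * t as above, the vertices p ^ (m + 1) and t.
nonadjacent-pair : ∀ n .{{_ : NonZero n}} → ¬ IsPrimePower n →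
  Σ (Fin n) λ a → Σ (Fin n) λ b → a ≢ b × ¬ Adj n a b
nonadjacent-pair n not-pp with split-prime-power n not-pp
... | p , m , t , p-prime , n≡ , p∤t , t≥2 = a , b , a≢b , a≁b
  where
  P = p ^ suc m
  instance
    p≢0 : NonZero p
    p≢0 = prime⇒nonZero p-prime
    P≢0 : NonZero P
    P≢0 = m^n≢0 p (suc m)
  P≥2 : 2 ≤ P
  P≥2 = ≤-trans (prime≥2 p-prime) (m≤m*n p (p ^ m) {{m^n≢0 p m}})
  P<n : P < n
  P<n = subst (P <_) (sym n≡) (m<m*n P t t≥2)
  t<n : t < n
  t<n = subst (t <_) (trans (*-comm t P) (sym n≡)) (m<m*n t P {{>-nonZero (≤-trans (s≤s z≤n) t≥2)}} P≥2)
  a b : Fin n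
  a = fromℕ< P<n
  b = fromℕ< t<n
  p∣P : p ∣ P
  p∣P = m∣m*n (p ^ m)
  p∣n : p ∣ n
  p∣n = subst (p ∣_) (sym n≡) (∣m⇒∣m*n t p∣P)
  t∣n : t ∣ n
  t∣n = subst (t ∣_) (sym n≡) (n∣m*n P)
  a≢b : a ≢ b
  a≢b a≡b = p∤t (subst (p ∣_) (trans (sym (toℕ-fromℕ< P<n)) (trans (cong toℕ a≡b) (toℕ-fromℕ< t<n))) p∣P)
  a≁b : ¬ Adj n a b
  a≁b (_ , inj₁ (k , _ , kP≡t)) =
    p∤t (subst (p ∣_) (trans kP≡t (toℕ-fromℕ< t<n)) (∣-multiple-mod k p∣n (subst (p ∣_) (sym (toℕ-fromℕ< P<n)) p∣P)))
  a≁b (_ , inj₂ (k , _ , kt≡P)) =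
    ∤prime-power (suc m) p-prime p∤t t≥2 (subst (t ∣_) (trans kt≡P (toℕ-fromℕ< P<n)) (∣-multiple-mod k t∣n (subst (t ∣_) (sym (toℕ-fromℕ< t<n)) ∣-refl)))

module _ {h n : ℕ} .{{_ : NonZero n}} (h*2≡n : h * 2 ≡ n) where

  even-multiple-of-half : ∀ {s} → 2 ∣ s → (s * h) % n ≡ 0
  even-multiple-of-half (divides r refl) = begin
    (r * 2 * h) % n   ≡⟨ cong (_% n) (*-assoc r 2 h) ⟩
    (r * (2 * h)) % n ≡⟨ cong (λ y → (r * y) % n) (trans (*-comm 2 h) h*2≡n) ⟩
    (r * n) % n       ≡⟨ m*n%n≡0 r n ⟩
    0                 ∎
    where open ≡-Reasoning

  odd-multiple-of-half : ∀ {s} → ¬ 2 ∣ s → (s * h) % n ≡ h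
  odd-multiple-of-half {s} 2∤s = begin
    (s * h) % n                         ≡⟨ cong (λ y → (y * h) % n) (m≡m%n+[m/n]*n s 2) ⟩
    ((s % 2 + s / 2 * 2) * h) % n       ≡⟨ cong (λ y → ((y + s / 2 * 2) * h) % n) (odd⇒%2≡1 s 2∤s) ⟩
    ((1 + s / 2 * 2) * h) % n           ≡⟨ cong (_% n) (expand (s / 2) h) ⟩
    (h + s / 2 * (h * 2)) % n           ≡⟨ cong (λ y → (h + s / 2 * y) % n) h*2≡n ⟩
    (h + s / 2 * n) % n                 ≡⟨ [m+kn]%n≡m%n h (s / 2) n ⟩
    h % n                               ≡⟨ m<n⇒m%n≡m h<n ⟩
    h                                   ∎
    where
    open ≡-Reasoning
    expand : ∀ r h → (1 + r * 2) * h ≡ h + r * (h * 2)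
    expand = solve-∀
    h<n : h < n
    h<n = subst (h <_) h*2≡n (m<m*n h 2 {{≢-nonZero h≢0}} (s≤s (s≤s z≤n)))
      where
      h≢0 : h ≢ 0
      h≢0 refl = ≢-nonZero⁻¹ n (sym h*2≡n)

module HalfVertex {n : ℕ} .{{_ : NonZero n}} (h : Fin n) (h*2≡n : toℕ h * 2 ≡ n)
  (β q : ℕ) (n≡Dq : n ≡ 2 ^ suc β * q) (q-odd : ¬ 2 ∣ q) where

  D : ℕ
  D = 2 ^ suc β

  h≡2^βq : toℕ h ≡ 2 ^ β * q
  h≡2^βq = *-cancelʳ-≡ (toℕ h) (2 ^ β * q) 2 (begin
    toℕ h * 2        ≡⟨ h*2≡n ⟩
    n                ≡⟨ n≡Dq ⟩
    2 * 2 ^ β * q    ≡⟨ regroup (2 ^ β) q ⟩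
    2 ^ β * q * 2    ∎)
    where
    open ≡-Reasoning
    regroup : ∀ a q → 2 * a * q ≡ a * q * 2
    regroup = solve-∀

  D∣n : D ∣ n
  D∣n = divides q (trans n≡Dq (*-comm D q))

  D∤h : ¬ D ∣ toℕ h
  D∤h D∣h = q-odd (*-cancelˡ-∣ (2 ^ β) {{m^n≢0 2 β}} (subst₂ _∣_ (*-comm 2 (2 ^ β)) h≡2^βq D∣h))

  half-neighbour⁻ : ∀ {u} → Adj n u h → toℕ u ≡ 0 ⊎ ¬ D ∣ toℕ u
  half-neighbour⁻ {u} (u≢h , u~h) with toℕ u ≟ℕ 0
  ... | yes u≡0 = inj₁ u≡0
  ... | no  u≢0 = inj₂ (λ D∣u → excluded D∣u u~h)
    where
    excluded : D ∣ toℕ u → IsMultiple n u h ⊎ IsMultiple n h u → ⊥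
    -- a multiple of u is again a multiple of D, unlike h
    excluded D∣u (inj₁ (k , _ , ku≡h)) = D∤h (subst (D ∣_) ku≡h (∣-multiple-mod k D∣n D∣u))
    -- the multiples of h are 0 and h
    excluded D∣u (inj₂ (k , _ , kh≡u)) with 2 ∣? k
    ... | yes 2∣k = u≢0 (trans (sym kh≡u) (even-multiple-of-half h*2≡n 2∣k))
    ... | no  2∤k = u≢h (toℕ-injective (trans (sym kh≡u) (odd-multiple-of-half h*2≡n 2∤k)))

  half-neighbour⁺ : ∀ {u} → u ≢ h → toℕ u ≡ 0 ⊎ ¬ D ∣ toℕ u → Adj n u h
  -- 0 = 2h
  half-neighbour⁺ {u} u≢h (inj₁ u≡0) =
    u≢h , inj₂ (2 , s≤s z≤n , trans (cong (_% n) (trans (*-comm 2 (toℕ h)) h*2≡n)) (trans (n%n≡0 n) (sym u≡0)))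
  -- u = 2 ^ γ * s with s odd and γ ≤ β, so 2 ^ (β ∸ γ) * q * u = s * h ≡ h
  half-neighbour⁺ {u} u≢h (inj₂ D∤u)
    with factor-out 2 (s≤s (s≤s z≤n)) (toℕ u) (n≢0⇒n>0 λ u≡0 → D∤u (subst (D ∣_) (sym u≡0) (D ∣0)))
  ... | γ , s , u≡2^γs , s-odd with γ ≤? β
  ...   | no  γ≰β = ⊥-elim (D∤u (subst (D ∣_) (sym u≡2^γs) (∣m⇒∣m*n s (^-∣ 2 (≰⇒> γ≰β)))))
  ...   | yes γ≤β = u≢h , inj₁ (k , k≥1 , ku≡h)
    where
    k = 2 ^ (β ∸ γ) * q
    k≥1 : 1 ≤ k
    k≥1 = >-nonZero⁻¹ k {{m*n≢0 (2 ^ (β ∸ γ)) q {{m^n≢0 2 (β ∸ γ)}} {{≢-nonZero λ { refl → q-odd (2 ∣0) }}}}}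
    ku≡h : (k * toℕ u) % n ≡ toℕ h
    ku≡h = begin
      (k * toℕ u) % n                       ≡⟨ cong (λ y → (k * y) % n) u≡2^γs ⟩
      (2 ^ (β ∸ γ) * q * (2 ^ γ * s)) % n   ≡⟨ cong (_% n) (regroup (2 ^ (β ∸ γ)) (2 ^ γ) q s) ⟩
      (s * (2 ^ (β ∸ γ) * 2 ^ γ * q)) % n   ≡⟨ cong (λ y → (s * (y * q)) % n) (sym (^-distribˡ-+-* 2 (β ∸ γ) γ)) ⟩
      (s * (2 ^ (β ∸ γ + γ) * q)) % n       ≡⟨ cong (λ y → (s * (2 ^ y * q)) % n) (m∸n+n≡m γ≤β) ⟩
      (s * (2 ^ β * q)) % n                 ≡⟨ cong (λ y → (s * y) % n) (sym h≡2^βq) ⟩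
      (s * toℕ h) % n                       ≡⟨ odd-multiple-of-half h*2≡n s-odd ⟩
      toℕ h                                 ∎
      where
      open ≡-Reasoning
      regroup : ∀ a b q s → a * q * (b * s) ≡ s * (a * b * q)
      regroup = solve-∀

  -- Hence N(h) − {0} = (non-multiples of D) − {h}; as q of the n vertices are multiples
  -- of D, deg h = n − q.
  half-degree : ∀ {d} → HasDegree n h d → d ≡ n ∸ q
  half-degree {d} deg = begin
    d                 ≡⟨ ∣N∣ ⟨
    ∣ N ∣             ≡⟨ ∣p∣≡1+∣p-x∣ z∈N ⟩
    suc ∣ N - z ∣     ≡⟨ cong (λ p → suc ∣ p ∣) (⊆-antisym N-z⊆ ⊆N-z) ⟩
    suc ∣ ∁ M - h ∣   ≡⟨ ∣p∣≡1+∣p-x∣ h∈∁M ⟨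
    ∣ ∁ M ∣           ≡⟨ ∣∁p∣≡n∸∣p∣ M ⟩
    n ∸ ∣ M ∣         ≡⟨ cong (n ∸_) ∣M∣ ⟩
    n ∸ q             ∎
    where
    open ≡-Reasoning
    open Neighbourhood deg
    M : Subset n
    M = below (D ∣?_) n
    ∣M∣ : ∣ M ∣ ≡ q
    ∣M∣ = trans (cong (count (D ∣?_)) (trans n≡Dq (*-comm D q))) (count-multiples D (m^n>0 2 (suc β)) q)
    ∈∁M⁺ : ∀ {i} → ¬ D ∣ toℕ i → i ∈ₛ ∁ M
    ∈∁M⁺ D∤i = x∉p⇒x∈∁p (λ i∈M → D∤i (∈⟦⟧⁻ (λ (i : Fin n) → D ∣? toℕ i) i∈M))
    ∈∁M⁻ : ∀ {i} → i ∈ₛ ∁ M → ¬ D ∣ toℕ i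
    ∈∁M⁻ i∈∁M D∣i = x∈∁p⇒x∉p i∈∁M (∈⟦⟧⁺ (λ (i : Fin n) → D ∣? toℕ i) D∣i)
    z : Fin n
    z = fromℕ< (>-nonZero⁻¹ n)
    z≡0 : toℕ z ≡ 0
    z≡0 = toℕ-fromℕ< (>-nonZero⁻¹ n)
    ≢z : ∀ {i} → ¬ D ∣ toℕ i → i ≢ z
    ≢z D∤i refl = D∤i (subst (D ∣_) (sym z≡0) (D ∣0))
    z∈N : z ∈ₛ N
    z∈N = ∈N⁺ (half-neighbour⁺ (λ z≡h → ≢z D∤h (sym z≡h)) (inj₁ z≡0))
    h∈∁M : h ∈ₛ ∁ M
    h∈∁M = ∈∁M⁺ D∤h
    N-z⊆ : ∀ {i} → i ∈ₛ N - z → i ∈ₛ ∁ M - h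
    N-z⊆ {i} i∈ with ∈-remove⁻ {p = N} i∈
    ... | i∈N , i≢z with ∈N⁻ i∈N
    ...   | ih@(i≢h , _) with half-neighbour⁻ ih
    ...     | inj₁ i≡0 = ⊥-elim (i≢z (toℕ-injective (trans i≡0 (sym z≡0))))
    ...     | inj₂ D∤i = x∈p∧x≢y⇒x∈p-y (∈∁M⁺ D∤i) i≢h
    ⊆N-z : ∀ {i} → i ∈ₛ ∁ M - h → i ∈ₛ N - z
    ⊆N-z {i} i∈ with ∈-remove⁻ {p = ∁ M} i∈
    ... | i∈∁M , i≢h = x∈p∧x≢y⇒x∈p-y (∈N⁺ (half-neighbour⁺ i≢h (inj₂ (∈∁M⁻ i∈∁M)))) (≢z (∈∁M⁻ i∈∁M))

κ-degree-vertex-is-half : ∀ {n} .{{_ : NonZero n}} → ¬ IsPrimePower n → ∀ {k v} →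
  IsConnectivity n k → HasDegree n v k → toℕ v * 2 ≡ n
κ-degree-vertex-is-half {n} not-pp {k} {v} conn deg = by-cases (dominates-or-misses v N)
  where
  open Neighbourhood deg
  by-cases : (∀ u → u ≢ v → u ∈ₛ N) ⊎ Σ (Fin n) (λ y → y ≢ v × y ∉ₛ N) → toℕ v * 2 ≡ n
  by-cases (inj₁ dominating) =
    let a , b , a≢b , a≁b = nonadjacent-pair n not-pp
    in ⊥-elim (no-small-cut conn (dominating-cut deg (λ u u≢v → ∈N⁻ (dominating u u≢v)) a≢b a≁b))
  by-cases (inj₂ (y , y≢v , y∉N)) with toℕ v * 2 ≟ℕ n | toℕ v ≟ℕ 0
  ... | yes v*2≡n | _       = v*2≡n
  ... | no  _     | yes v≡0 = ⊥-elim (y∉N (∈N⁺ (adjacent-to-zero v≡0 y≢v)))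
  ... | no  v*2≢n | no  v≢0 =
    let w , w≢v , v∣w , w∣v = negative-twin v v≢0 v*2≢n
    in ⊥-elim (no-small-cut conn (twin-cut deg (w≢v , inj₁ w∣v) (twin-neighbours v∣w w∣v) y≢v (λ y~v → y∉N (∈N⁺ y~v))))

theorem6p4 : (n : ℕ) .{{_ : NonZero n}} → ¬ IsPrimePower n → (k : ℕ) →
    IsConnectivity n k → IsMinDegree n k →
    2 ∣ n ×
    (∀ (v : Fin n) → toℕ v * 2 ≡ n → HasDegree n v k) ×
    (∀ (α q : ℕ) → n ≡ 2 ^ α * q → ¬ (2 ^ suc α ∣ n) → k ≡ n ∸ q)
theorem6p4 n not-pp k conn ((v , deg) , _) = 2∣n , degree-of-half , degree≡n∸q
  where
  v*2≡n : toℕ v * 2 ≡ n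
  v*2≡n = κ-degree-vertex-is-half not-pp conn deg
  2∣n : 2 ∣ n
  2∣n = divides (toℕ v) (sym v*2≡n)
  -- n/2 is the only vertex u with 2u = n, so it is v
  degree-of-half : ∀ u → toℕ u * 2 ≡ n → HasDegree n u k
  degree-of-half u u*2≡n = subst (λ w → HasDegree n w k) (toℕ-injective (*-cancelʳ-≡ _ _ 2 (trans v*2≡n (sym u*2≡n)))) deg
  -- n is even, so α ≥ 1, and deg(n/2) = n − q
  degree≡n∸q : ∀ α q → n ≡ 2 ^ α * q → ¬ 2 ^ suc α ∣ n → k ≡ n ∸ q
  degree≡n∸q zero      q _  2∤n = ⊥-elim (2∤n 2∣n)
  degree≡n∸q (suc β) q n≡ 2^[2+β]∤n = HalfVertex.half-degree v v*2≡n β q n≡ (odd-part {α = suc β} n≡ 2^[2+β]∤n) deg
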